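{- Let $n,m$ be positive integers. If $\mathbf{bp}_{or}(K_m)\le n$, then there exists a graph $G$ on $n$ vertices having a fooling set of size $m$.
   Context: For a graph $G$, a fooling set is a set $\mathcal C$ of pairs $(K,S)$ where $K$ is a clique and $S$ a stable set of $G$ (possibly empty) with $K\cap S=\emptyset$, such that for any two distinct pairs $(K,S),(K',S')\in\mathcal C$, $K\cap S'\neq\emptyset$ or $K'\cap S\neq\emptyset$. $K_m$ is the complete graph on $m$ vertices. The oriented bipartite packing $\mathbf{bp}_{or}(H)$ of an undirected graph $H$ is the minimum $k$ such that there exist pairs $(A_1,B_1),\dots,(A_k,B_k)$ of disjoint vertex subsets with every vertex of $A_i$ adjacent to every vertex of $B_i$, such that every edge $xy$ satisfies $x\in A_i,y\in B_i$ or $y\in A_i,x\in B_i$ for some $i$, and there is no ordered pair $(x,y)$ and distinct $i\neq j$ with $x\in A_i\cap A_j$ and $y\in B_i\cap B_j$. -}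

module Defs where


open import Data.Nat using (ℕ; _≤_)
open import Data.Fin using (Fin)
open import Data.Fin.Subset using (Subset; _∈_)
open import Data.Product using (Σ; ∃; _×_; _,_)
open import Data.Sum using (_⊎_)
open import Relation.Binary.PropositionalEquality using (_≡_; _≢_; sym)
open import Relation.Nullary using (¬_)

record Graph (n : ℕ) : Set₁ where
  field
    Adj   : Fin n → Fin n → Set
    Adj-sym : ∀ {x y} → Adj x y → Adj y x
    Adj-irrefl : ∀ {x} → ¬ Adj x x
open Graph public

K : (m : ℕ) → Graph m
K m = record { Adj = λ x y → x ≢ y ; Adj-sym = λ p q → p (sym q) ; Adj-irrefl = λ p → p _≡_.refl }

module _ {n : ℕ} (G : Graph n) where

  IsClique : Subset n → Set
  IsClique C = ∀ x y → x ∈ C → y ∈ C → x ≢ y → Adj G x y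

  IsStable : Subset n → Set
  IsStable S = ∀ x y → x ∈ S → y ∈ S → ¬ Adj G x y

  Meets : Subset n → Subset n → Set
  Meets A B = ∃ λ x → x ∈ A × x ∈ B

  Disjoint : Subset n → Subset n → Set
  Disjoint A B = ¬ Meets A B

  -- A fooling set of size m: m pairs (K_i , S_i) with K_i a clique,
  -- S_i a stable set, K_i ∩ S_i = ∅, and for i ≠ j,
  -- K_i ∩ S_j ≠ ∅ or K_j ∩ S_i ≠ ∅.  (The last condition forces the
  -- m pairs to be pairwise distinct, so this is a set of size m.)
  IsFoolingSet : (m : ℕ) → (Fin m → Subset n) → (Fin m → Subset n) → Set
  IsFoolingSet m Kf Sf =
      (∀ i → IsClique (Kf i))
    × (∀ i → IsStable (Sf i))
    × (∀ i → Disjoint (Kf i) (Sf i))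
    × (∀ i j → i ≢ j → Meets (Kf i) (Sf j) ⊎ Meets (Kf j) (Sf i))

  HasFoolingSetOfSize : ℕ → Set
  HasFoolingSetOfSize m =
    Σ (Fin m → Subset n) λ Kf → Σ (Fin m → Subset n) λ Sf → IsFoolingSet m Kf Sf

  IsOrientedBipartitePacking : (k : ℕ) → (Fin k → Subset n) → (Fin k → Subset n) → Set
  IsOrientedBipartitePacking k A B =
      (∀ i → Disjoint (A i) (B i))
    × (∀ i x y → x ∈ A i → y ∈ B i → Adj G x y)
    × (∀ x y → Adj G x y → ∃ λ i → (x ∈ A i × y ∈ B i) ⊎ (y ∈ A i × x ∈ B i))
    × (∀ x y i j → i ≢ j → ¬ (x ∈ A i × x ∈ A j × y ∈ B i × y ∈ B j))

  HasOrientedBipartitePacking : ℕ → Set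
  HasOrientedBipartitePacking k =
    Σ (Fin k → Subset n) λ A → Σ (Fin k → Subset n) λ B → IsOrientedBipartitePacking k A B

  -- bp_or(G) ≤ t  :⇔  the minimum k admitting such a packing is ≤ t,
  -- i.e. some packing with k ≤ t pairs exists.
  bpOr≤ : ℕ → Set
  bpOr≤ t = ∃ λ k → k ≤ t × HasOrientedBipartitePacking k

module Submission where

-- Pad a packing of K_m with empty pairs until it has exactly n pairs (A_i , B_i).
-- On the vertex set {1..n} let i ~ j when A_i and A_j share a vertex of K_m.
-- For a vertex v of K_m, the indices i with v ∈ A_i form a clique K_v and those
-- with v ∈ B_i a stable set S_v: an edge between two of the latter would give
-- u ∈ A_i ∩ A_j and v ∈ B_i ∩ B_j, which the packing forbids. Every edge uv of
-- K_m is covered by some pair, which places i in K_u ∩ S_v or in K_v ∩ S_u.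

open import Defs
open import Data.Nat using (ℕ; suc; _≤_; _≤′_; ≤′-refl; ≤′-step)
open import Data.Nat.Properties using (≤⇒≤′)
open import Data.Product using (Σ; _×_; _,_)
open import Data.Sum using (_⊎_; inj₁; inj₂)
open import Data.Fin using (Fin; zero; suc)
open import Data.Fin.Subset using (Subset; _∈_; ⊥)
open import Data.Fin.Subset.Properties using (∉⊥)
open import Data.Vec using (tabulate; lookup)
open import Data.Vec.Properties using (lookup∘tabulate; []=⇒lookup; lookup⇒[]=)
open import Data.Empty using (⊥-elim)
open import Relation.Nullary using (¬_)
open import Relation.Binary.PropositionalEquality using (_≢_; refl; sym; trans; cong)

transpose : ∀ {m n} → (Fin n → Subset m) → Fin m → Subset n
transpose A v = tabulate (λ i → lookup (A i) v)

module _ {m n : ℕ} (A : Fin n → Subset m) {i : Fin n} {v : Fin m} where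

  ∈-transpose⁺ : v ∈ A i → i ∈ transpose A v
  ∈-transpose⁺ v∈Ai =
    lookup⇒[]= i (transpose A v) (trans (lookup∘tabulate _ i) ([]=⇒lookup v∈Ai))

  ∈-transpose⁻ : i ∈ transpose A v → v ∈ A i
  ∈-transpose⁻ i∈Aᵀv =
    lookup⇒[]= v (A i) (trans (sym (lookup∘tabulate _ i)) ([]=⇒lookup i∈Aᵀv))

module _ {m : ℕ} (H : Graph m) where

  padPacking : ∀ {k} → HasOrientedBipartitePacking H k → HasOrientedBipartitePacking H (suc k)
  padPacking {k} (A , B , disjoint , complete , covers , unique) =
    A′ , B′ , disjoint′ , complete′ , covers′ , unique′
    where
    A′ B′ : Fin (suc k) → Subset m
    A′ zero    = ⊥
    A′ (suc i) = A i
    B′ zero    = ⊥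
    B′ (suc i) = B i

    disjoint′ : ∀ i → Disjoint H (A′ i) (B′ i)
    disjoint′ zero    (_ , x∈⊥ , _) = ∉⊥ x∈⊥
    disjoint′ (suc i) meet          = disjoint i meet

    complete′ : ∀ i x y → x ∈ A′ i → y ∈ B′ i → Adj H x y
    complete′ zero    x y x∈⊥ _ = ⊥-elim (∉⊥ x∈⊥)
    complete′ (suc i) x y       = complete i x y

    covers′ : ∀ x y → Adj H x y →
      Σ (Fin (suc k)) λ i → (x ∈ A′ i × y ∈ B′ i) ⊎ (y ∈ A′ i × x ∈ B′ i)
    covers′ x y xy with covers x y xy
    ... | i , cover = suc i , cover

    unique′ : ∀ x y i j → i ≢ j → ¬ (x ∈ A′ i × x ∈ A′ j × y ∈ B′ i × y ∈ B′ j)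
    unique′ x y zero    _       _   (x∈⊥ , _)     = ∉⊥ x∈⊥
    unique′ x y (suc i) zero    _   (_ , x∈⊥ , _) = ∉⊥ x∈⊥
    unique′ x y (suc i) (suc j) i≢j               = unique x y i j (λ i≡j → i≢j (cong suc i≡j))

  padPackingTo : ∀ {k n} → k ≤′ n → HasOrientedBipartitePacking H k → HasOrientedBipartitePacking H n
  padPackingTo ≤′-refl      packing = packing
  padPackingTo (≤′-step k≤n) packing = padPacking (padPackingTo k≤n packing)

  bpOr≤⇒packing : ∀ {n} → bpOr≤ H n → HasOrientedBipartitePacking H n
  bpOr≤⇒packing (k , k≤n , packing) = padPackingTo (≤⇒≤′ k≤n) packing

module _ {m n : ℕ} (A B : Fin n → Subset m) where

  overlapGraph : Graph n
  overlapGraph = record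
    { Adj        = λ i j → i ≢ j × Meets (K m) (A i) (A j)
    ; Adj-sym    = λ { (i≢j , v , v∈Ai , v∈Aj) → (λ j≡i → i≢j (sym j≡i)) , v , v∈Aj , v∈Ai }
    ; Adj-irrefl = λ { (i≢i , _) → i≢i refl }
    }

  packing⇒foolingSet : IsOrientedBipartitePacking (K m) n A B →
                       IsFoolingSet overlapGraph m (transpose A) (transpose B)
  packing⇒foolingSet (disjoint , _ , covers , unique) = clique , stable , disjoint′ , fooling
    where
    clique : ∀ v → IsClique overlapGraph (transpose A v)
    clique v i j i∈Kv j∈Kv i≢j = i≢j , v , ∈-transpose⁻ A i∈Kv , ∈-transpose⁻ A j∈Kv

    stable : ∀ v → IsStable overlapGraph (transpose B v)
    stable v i j i∈Sv j∈Sv (i≢j , u , u∈Ai , u∈Aj) =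
      unique u v i j i≢j (u∈Ai , u∈Aj , ∈-transpose⁻ B i∈Sv , ∈-transpose⁻ B j∈Sv)

    disjoint′ : ∀ v → Disjoint overlapGraph (transpose A v) (transpose B v)
    disjoint′ v (i , i∈Kv , i∈Sv) = disjoint i (v , ∈-transpose⁻ A i∈Kv , ∈-transpose⁻ B i∈Sv)

    fooling : ∀ u v → u ≢ v →
      Meets overlapGraph (transpose A u) (transpose B v) ⊎
      Meets overlapGraph (transpose A v) (transpose B u)
    fooling u v u≢v with covers u v u≢v
    ... | i , inj₁ (u∈Ai , v∈Bi) = inj₁ (i , ∈-transpose⁺ A u∈Ai , ∈-transpose⁺ B v∈Bi)
    ... | i , inj₂ (v∈Ai , u∈Bi) = inj₂ (i , ∈-transpose⁺ A v∈Ai , ∈-transpose⁺ B u∈Bi)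

lemma16 : (n m : ℕ) → 1 ≤ n → 1 ≤ m → bpOr≤ (K m) n →
    Σ (Graph n) λ G → HasFoolingSetOfSize G m
lemma16 n m _ _ bp with bpOr≤⇒packing (K m) bp
... | A , B , packing =
  overlapGraph A B , transpose A , transpose B , packing⇒foolingSet A B packing
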